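{- Let $q\ge 3$ and let $n,d,w$ be positive integers. Then $A_q^L(n,d)\le A_2\!\left(n\lceil wq/2\rceil,\, dw\right)$.
   Context: On $\mathbb{Z}_q=\{0,1,\dots,q-1\}$ the Lee distance is $d_L(i,j)=\min\{|i-j|,\,q-|i-j|\}$, extended to $\mathbb{Z}_q^n$ by summing over coordinates. $A_q^L(n,d)$ is the maximum size of a code $C\subseteq\mathbb{Z}_q^n$ whose distinct codewords have Lee distance at least $d$. $A_2(N,d)$ is the maximum size of a binary code $C\subseteq\{0,1\}^N$ whose distinct codewords have Hamming distance at least $d$. (The paper phrases this via the cycle $C_q$ with constant edge weight $w$.) -}

module Defs where

open import Data.Nat using (ℕ; zero; suc; _+_; _*_; _∸_; _⊓_; _≤_; ∣_-_∣; ⌈_/2⌉)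
open import Data.Fin using (Fin; toℕ)
open import Data.Bool using (Bool; true; false; if_then_else_)
open import Data.Vec using (Vec; []; _∷_)
open import Data.List using (List; length)
open import Data.List.Relation.Unary.AllPairs using (AllPairs)
open import Data.Product using (Σ; _×_)
open import Relation.Binary.PropositionalEquality using (_≡_; _≢_)
open import Relation.Nullary using (does)

leeDist₁ : {q : ℕ} → Fin q → Fin q → ℕ
leeDist₁ {q} i j = ∣ toℕ i - toℕ j ∣ ⊓ (q ∸ ∣ toℕ i - toℕ j ∣)

leeDist : {q n : ℕ} → Vec (Fin q) n → Vec (Fin q) n → ℕ
leeDist [] [] = 0
leeDist (x ∷ xs) (y ∷ ys) = leeDist₁ x y + leeDist xs ys

bitDiff : Bool → Bool → ℕ
bitDiff true  true  = 0
bitDiff false false = 0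
bitDiff true  false = 1
bitDiff false true  = 1

hamming : {N : ℕ} → Vec Bool N → Vec Bool N → ℕ
hamming [] [] = 0
hamming (x ∷ xs) (y ∷ ys) = bitDiff x y + hamming xs ys

IsCode : {A : Set} → (A → A → ℕ) → ℕ → List A → Set
IsCode dist d C = AllPairs (λ x y → x ≢ y × d ≤ dist x y) C

IsMaxCodeSize : {A : Set} → (A → A → ℕ) → ℕ → ℕ → Set
IsMaxCodeSize {A} dist d m =
  Σ (List A) (λ C → IsCode dist d C × length C ≡ m)
  × ((C : List A) → IsCode dist d C → length C ≤ m)

IsA-Lee : ℕ → ℕ → ℕ → ℕ → Set
IsA-Lee q n d m = IsMaxCodeSize (leeDist {q} {n}) d m

IsA-bin : ℕ → ℕ → ℕ → Set
IsA-bin N d m = IsMaxCodeSize (hamming {N}) d m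

-- Rescaling all Lee distances by w turns ℤ_q into w q equally spaced points on a cycle of
-- length 2M, where M = ⌈w q / 2⌉, and a cycle of even length 2M embeds isometrically into
-- the Hamming cube {0,1}^M: write a ≤ M as 1^a 0^(M-a) and M + c as the complement of
-- the word for c. Concatenating the n coordinates multiplies all Lee distances by w,
-- so a Lee code of minimum distance d becomes a binary code of minimum distance d w.
module Submission where

open import Defs
open import Data.Nat using (ℕ; zero; suc; _+_; _*_; _∸_; _⊓_; _≤_; _≥_; ∣_-_∣; ⌊_/2⌋; ⌈_/2⌉; _≤?_; z≤n; s≤s)
open import Data.Nat.Properties
open import Data.Fin using (Fin; toℕ)
open import Data.Fin.Properties using (toℕ<n)
open import Data.Bool using (Bool; true; false; not)
open import Data.Vec using (Vec; []; _∷_; _++_; map)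
import Data.List as List
open import Data.List.Properties using (length-map)
import Data.List.Relation.Unary.AllPairs as AllPairs
open import Data.List.Relation.Unary.AllPairs.Properties using (map⁺)
open import Data.Product using (_,_)
open import Relation.Binary.PropositionalEquality
open import Relation.Nullary using (yes; no; ¬_)
open import Data.Sum using (inj₁; inj₂)
open import Function using (_∘_)

bitDiff-comm : ∀ x y → bitDiff x y ≡ bitDiff y x
bitDiff-comm true  true  = refl
bitDiff-comm true  false = refl
bitDiff-comm false true  = refl
bitDiff-comm false false = refl

hamming-comm : ∀ {N} (u v : Vec Bool N) → hamming u v ≡ hamming v u
hamming-comm []       []       = refl
hamming-comm (x ∷ u) (y ∷ v) = cong₂ _+_ (bitDiff-comm x y) (hamming-comm u v)

hamming[u,u]≡0 : ∀ {N} (u : Vec Bool N) → hamming u u ≡ 0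
hamming[u,u]≡0 []          = refl
hamming[u,u]≡0 (true ∷ u)  = hamming[u,u]≡0 u
hamming[u,u]≡0 (false ∷ u) = hamming[u,u]≡0 u

hamming-++ : ∀ {m k} (u u′ : Vec Bool m) (v v′ : Vec Bool k) →
  hamming (u ++ v) (u′ ++ v′) ≡ hamming u u′ + hamming v v′
hamming-++ []      []       v v′ = refl
hamming-++ (x ∷ u) (y ∷ u′) v v′ =
  trans (cong (bitDiff x y +_) (hamming-++ u u′ v v′)) (sym (+-assoc (bitDiff x y) _ _))

hamming-map-not : ∀ {N} (u v : Vec Bool N) → hamming (map not u) (map not v) ≡ hamming u v
hamming-map-not []          []          = refl
hamming-map-not (true ∷ u)  (true ∷ v)  = hamming-map-not u v
hamming-map-not (true ∷ u)  (false ∷ v) = cong suc (hamming-map-not u v)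
hamming-map-not (false ∷ u) (true ∷ v)  = cong suc (hamming-map-not u v)
hamming-map-not (false ∷ u) (false ∷ v) = hamming-map-not u v

hamming-map-notʳ : ∀ {N} (u v : Vec Bool N) → hamming u (map not v) + hamming u v ≡ N
hamming-map-notʳ []          []          = refl
hamming-map-notʳ (true ∷ u)  (true ∷ v)  = cong suc (hamming-map-notʳ u v)
hamming-map-notʳ (true ∷ u)  (false ∷ v) = trans (+-suc _ _) (cong suc (hamming-map-notʳ u v))
hamming-map-notʳ (false ∷ u) (true ∷ v)  = trans (+-suc _ _) (cong suc (hamming-map-notʳ u v))
hamming-map-notʳ (false ∷ u) (false ∷ v) = cong suc (hamming-map-notʳ u v)

thermometer : (M a : ℕ) → Vec Bool M
thermometer zero    a       = []
thermometer (suc M) zero    = false ∷ thermometer M 0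
thermometer (suc M) (suc a) = true ∷ thermometer M a

hamming-thermometer : ∀ {M a b} → a ≤ M → b ≤ M →
  hamming (thermometer M a) (thermometer M b) ≡ ∣ a - b ∣
hamming-thermometer {zero}  z≤n       z≤n       = refl
hamming-thermometer {suc M} {zero}  {zero}  _ _ = hamming-thermometer {M} z≤n z≤n
hamming-thermometer {suc M} {suc a} {zero}  (s≤s a≤M) _ =
  cong suc (trans (hamming-thermometer a≤M z≤n) (∣-∣-identityʳ a))
hamming-thermometer {suc M} {zero}  {suc b} _ (s≤s b≤M) =
  cong suc (hamming-thermometer z≤n b≤M)
hamming-thermometer {suc M} {suc a} {suc b} (s≤s a≤M) (s≤s b≤M) =
  hamming-thermometer a≤M b≤M

hamming-thermometer-map-not : ∀ {M a c} → a ≤ M → c ≤ M →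
  hamming (thermometer M a) (map not (thermometer M c)) ≡ M ∸ ∣ a - c ∣
hamming-thermometer-map-not {M} {a} {c} a≤M c≤M = begin
  h                          ≡⟨ sym (m+n∸n≡m h ∣ a - c ∣) ⟩
  h + ∣ a - c ∣ ∸ ∣ a - c ∣    ≡⟨ cong (λ t → h + t ∸ ∣ a - c ∣) (sym (hamming-thermometer a≤M c≤M)) ⟩
  h + hamming tₐ t꜀ ∸ ∣ a - c ∣ ≡⟨ cong (_∸ ∣ a - c ∣) (hamming-map-notʳ tₐ t꜀) ⟩
  M ∸ ∣ a - c ∣               ∎
  where
  open ≡-Reasoning
  tₐ = thermometer M a
  t꜀ = thermometer M c
  h  = hamming tₐ (map not t꜀)

-- leeDist₁ x y is definitionally cycDist q (toℕ x) (toℕ y).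
cycDist : ℕ → ℕ → ℕ → ℕ
cycDist L a b = ∣ a - b ∣ ⊓ (L ∸ ∣ a - b ∣)

cycDist-comm : ∀ L a b → cycDist L a b ≡ cycDist L b a
cycDist-comm L a b = cong (λ t → t ⊓ (L ∸ t)) (∣-∣-comm a b)

cycDist-translate : ∀ L m a b → cycDist L (m + a) (m + b) ≡ cycDist L a b
cycDist-translate L m a b = cong (λ t → t ⊓ (L ∸ t)) (∣m+n-m+o∣≡∣n-o∣ m a b)

cycDist-monoˡ-≤ : ∀ {L L′} a b → L ≤ L′ → cycDist L a b ≤ cycDist L′ a b
cycDist-monoˡ-≤ a b L≤L′ = ⊓-monoʳ-≤ ∣ a - b ∣ (∸-monoˡ-≤ ∣ a - b ∣ L≤L′)

*-distribˡ-cycDist : ∀ w L a b → w * cycDist L a b ≡ cycDist (w * L) (w * a) (w * b)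
*-distribˡ-cycDist w L a b = begin
  w * (δ ⊓ (L ∸ δ))             ≡⟨ *-distribˡ-⊓ w δ (L ∸ δ) ⟩
  (w * δ) ⊓ (w * (L ∸ δ))       ≡⟨ cong ((w * δ) ⊓_) (*-distribˡ-∸ w L δ) ⟩
  (w * δ) ⊓ (w * L ∸ w * δ)     ≡⟨ cong (λ t → t ⊓ (w * L ∸ t)) (*-distribˡ-∣-∣ w a b) ⟩
  cycDist (w * L) (w * a) (w * b) ∎
  where
  open ≡-Reasoning
  δ = ∣ a - b ∣

cycDist≡∣-∣ : ∀ {M a b} → a ≤ M → b ≤ M → cycDist (M + M) a b ≡ ∣ a - b ∣
cycDist≡∣-∣ {M} {a} {b} a≤M b≤M = m≤n⇒m⊓n≡m (begin
  ∣ a - b ∣           ≤⟨ δ≤M ⟩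
  M                 ≤⟨ m≤m+n M (M ∸ ∣ a - b ∣) ⟩
  M + (M ∸ ∣ a - b ∣) ≡⟨ +-∸-assoc M δ≤M ⟨
  M + M ∸ ∣ a - b ∣   ∎)
  where
  open ≤-Reasoning
  δ≤M : ∣ a - b ∣ ≤ M
  δ≤M = ≤-trans (∣m-n∣≤m⊔n a b) (⊔-lub a≤M b≤M)

cycDist-antipode : ∀ {M a c} → a ≤ M → c ≤ M → cycDist (M + M) a (M + c) ≡ M ∸ ∣ a - c ∣
cycDist-antipode {M} {a} {c} a≤M c≤M with ≤-total c a
... | inj₁ c≤a = begin
  cycDist (M + M) a (M + c)      ≡⟨ cong (λ t → t ⊓ (M + M ∸ t)) far≡ ⟩
  (M ∸ e) ⊓ (M + M ∸ (M ∸ e))   ≡⟨ cong ((M ∸ e) ⊓_) (+-∸-assoc M (m∸n≤m M e)) ⟩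
  (M ∸ e) ⊓ (M + (M ∸ (M ∸ e))) ≡⟨ cong (λ t → (M ∸ e) ⊓ (M + t)) (m∸[m∸n]≡n e≤M) ⟩
  (M ∸ e) ⊓ (M + e)             ≡⟨ m≤n⇒m⊓n≡m (≤-trans (m∸n≤m M e) (m≤m+n M e)) ⟩
  M ∸ e                         ≡⟨ cong (M ∸_) (m≤n⇒∣n-m∣≡n∸m c≤a) ⟨
  M ∸ ∣ a - c ∣                  ∎
  where
  open ≡-Reasoning
  e = a ∸ c
  e≤M : e ≤ M
  e≤M = ≤-trans (m∸n≤m a c) a≤M
  far≡ : ∣ a - (M + c) ∣ ≡ M ∸ e
  far≡ = begin
    ∣ a - (M + c) ∣    ≡⟨ m≤n⇒∣m-n∣≡n∸m (≤-trans a≤M (m≤m+n M c)) ⟩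
    M + c ∸ a         ≡⟨ cong (M + c ∸_) (m+[n∸m]≡n c≤a) ⟨
    M + c ∸ (c + e)   ≡⟨ ∸-+-assoc (M + c) c e ⟨
    M + c ∸ c ∸ e     ≡⟨ cong (_∸ e) (m+n∸n≡m M c) ⟩
    M ∸ e             ∎
... | inj₂ a≤c = begin
  cycDist (M + M) a (M + c)      ≡⟨ cong (λ t → t ⊓ (M + M ∸ t)) far≡ ⟩
  (M + e) ⊓ (M + M ∸ (M + e))   ≡⟨ cong ((M + e) ⊓_) ([m+n]∸[m+o]≡n∸o M M e) ⟩
  (M + e) ⊓ (M ∸ e)             ≡⟨ m≥n⇒m⊓n≡n (≤-trans (m∸n≤m M e) (m≤m+n M e)) ⟩
  M ∸ e                         ≡⟨ cong (M ∸_) (m≤n⇒∣m-n∣≡n∸m a≤c) ⟨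
  M ∸ ∣ a - c ∣                  ∎
  where
  open ≡-Reasoning
  e = c ∸ a
  far≡ : ∣ a - (M + c) ∣ ≡ M + e
  far≡ = trans (m≤n⇒∣m-n∣≡n∸m (≤-trans a≤M (m≤m+n M c))) (+-∸-assoc M a≤c)

cycleEmbedding : (M a : ℕ) → Vec Bool M
cycleEmbedding M a with a ≤? M
... | yes _ = thermometer M a
... | no  _ = map not (thermometer M (a ∸ M))

hamming-near-far : ∀ {M a b} → a ≤ M → ¬ b ≤ M → b ≤ M + M →
  hamming (thermometer M a) (map not (thermometer M (b ∸ M))) ≡ cycDist (M + M) a b
hamming-near-far {M} {a} {b} a≤M b≰M b≤2M = begin
  hamming (thermometer M a) (map not (thermometer M (b ∸ M))) ≡⟨ hamming-thermometer-map-not a≤M b∸M≤M ⟩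
  M ∸ ∣ a - (b ∸ M) ∣                                         ≡⟨ cycDist-antipode a≤M b∸M≤M ⟨
  cycDist (M + M) a (M + (b ∸ M))                            ≡⟨ cong (cycDist (M + M) a) (m+[n∸m]≡n (≰⇒≥ b≰M)) ⟩
  cycDist (M + M) a b                                        ∎
  where
  open ≡-Reasoning
  b∸M≤M = m≤n+o⇒m∸n≤o b M b≤2M

hamming-far-far : ∀ {M a b} → ¬ a ≤ M → a ≤ M + M → ¬ b ≤ M → b ≤ M + M →
  hamming (map not (thermometer M (a ∸ M))) (map not (thermometer M (b ∸ M))) ≡ cycDist (M + M) a b
hamming-far-far {M} {a} {b} a≰M a≤2M b≰M b≤2M = begin
  hamming (map not (thermometer M a′)) (map not (thermometer M b′)) ≡⟨ hamming-map-not (thermometer M a′) (thermometer M b′) ⟩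
  hamming (thermometer M a′) (thermometer M b′)                    ≡⟨ hamming-thermometer a′≤M b′≤M ⟩
  ∣ a′ - b′ ∣                                                      ≡⟨ cycDist≡∣-∣ a′≤M b′≤M ⟨
  cycDist (M + M) a′ b′                                            ≡⟨ cycDist-translate (M + M) M a′ b′ ⟨
  cycDist (M + M) (M + a′) (M + b′)                                ≡⟨ cong₂ (cycDist (M + M)) (m+[n∸m]≡n (≰⇒≥ a≰M)) (m+[n∸m]≡n (≰⇒≥ b≰M)) ⟩
  cycDist (M + M) a b                                              ∎
  where
  open ≡-Reasoning
  a′ = a ∸ M
  b′ = b ∸ M
  a′≤M = m≤n+o⇒m∸n≤o a M a≤2M
  b′≤M = m≤n+o⇒m∸n≤o b M b≤2M

hamming-cycleEmbedding : ∀ M {a b} → a ≤ M + M → b ≤ M + M →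
  hamming (cycleEmbedding M a) (cycleEmbedding M b) ≡ cycDist (M + M) a b
hamming-cycleEmbedding M {a} {b} a≤2M b≤2M with a ≤? M | b ≤? M
... | yes a≤M | yes b≤M = trans (hamming-thermometer a≤M b≤M) (sym (cycDist≡∣-∣ a≤M b≤M))
... | yes a≤M | no  b≰M = hamming-near-far a≤M b≰M b≤2M
... | no  a≰M | yes b≤M = trans (hamming-comm (map not (thermometer M (a ∸ M))) (thermometer M b))
  (trans (hamming-near-far b≤M a≰M a≤2M) (cycDist-comm (M + M) b a))
... | no  a≰M | no  b≰M = hamming-far-far a≰M a≤2M b≰M b≤2M

module _ (q w : ℕ) where

  M : ℕ
  M = ⌈ w * q /2⌉

  wq≤2M : w * q ≤ M + M
  wq≤2M = begin
    w * q                 ≡⟨ ⌊n/2⌋+⌈n/2⌉≡n (w * q) ⟨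
    ⌊ w * q /2⌋ + M       ≤⟨ +-monoˡ-≤ M (⌊n/2⌋≤⌈n/2⌉ (w * q)) ⟩
    M + M                 ∎
    where open ≤-Reasoning

  encodeSymbol : Fin q → Vec Bool M
  encodeSymbol x = cycleEmbedding M (w * toℕ x)

  encode : ∀ {n} → Vec (Fin q) n → Vec Bool (n * M)
  encode []       = []
  encode (x ∷ xs) = encodeSymbol x ++ encode xs

  scaled-leeDist₁≤hamming : ∀ x y → w * leeDist₁ x y ≤ hamming (encodeSymbol x) (encodeSymbol y)
  scaled-leeDist₁≤hamming x y = begin
    w * cycDist q (toℕ x) (toℕ y)                   ≡⟨ *-distribˡ-cycDist w q (toℕ x) (toℕ y) ⟩
    cycDist (w * q) (w * toℕ x) (w * toℕ y)         ≤⟨ cycDist-monoˡ-≤ (w * toℕ x) (w * toℕ y) wq≤2M ⟩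
    cycDist (M + M) (w * toℕ x) (w * toℕ y)         ≡⟨ hamming-cycleEmbedding M (scaled≤2M x) (scaled≤2M y) ⟨
    hamming (encodeSymbol x) (encodeSymbol y)       ∎
    where
    open ≤-Reasoning
    scaled≤2M : ∀ z → w * toℕ z ≤ M + M
    scaled≤2M z = ≤-trans (*-monoʳ-≤ w (<⇒≤ (toℕ<n z))) wq≤2M

  scaled-leeDist≤hamming : ∀ {n} (xs ys : Vec (Fin q) n) → w * leeDist xs ys ≤ hamming (encode xs) (encode ys)
  scaled-leeDist≤hamming []       []       = ≤-reflexive (*-zeroʳ w)
  scaled-leeDist≤hamming (x ∷ xs) (y ∷ ys) = begin
    w * (leeDist₁ x y + leeDist xs ys)          ≡⟨ *-distribˡ-+ w (leeDist₁ x y) (leeDist xs ys) ⟩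
    w * leeDist₁ x y + w * leeDist xs ys         ≤⟨ +-mono-≤ (scaled-leeDist₁≤hamming x y) (scaled-leeDist≤hamming xs ys) ⟩
    hamming (encodeSymbol x) (encodeSymbol y) + hamming (encode xs) (encode ys)
                                                ≡⟨ hamming-++ (encodeSymbol x) (encodeSymbol y) (encode xs) (encode ys) ⟨
    hamming (encode (x ∷ xs)) (encode (y ∷ ys)) ∎
    where open ≤-Reasoning

module _ {A B : Set} {distA : A → A → ℕ} {distB : B → B → ℕ} {d d′ : ℕ} (f : A → B)
  (distB[u,u]≡0 : ∀ u → distB u u ≡ 0) (d′≥1 : d′ ≥ 1)
  (expanding : ∀ x y → d ≤ distA x y → d′ ≤ distB (f x) (f y)) where

  map-IsCode : ∀ {C} → IsCode distA d C → IsCode distB d′ (List.map f C)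
  map-IsCode = map⁺ ∘ AllPairs.map λ {x} {y} (_ , d≤) → let d′≤ = expanding x y d≤ in distinct d′≤ , d′≤
    where
    distinct : ∀ {u v} → d′ ≤ distB u v → u ≢ v
    distinct {u} d′≤ refl = <-irrefl refl (≤-trans d′≥1 (subst (d′ ≤_) (distB[u,u]≡0 u) d′≤))

  maxCodeSize-mono : ∀ {a b} → IsMaxCodeSize distA d a → IsMaxCodeSize distB d′ b → a ≤ b
  maxCodeSize-mono {a} {b} ((C , isCode , |C|≡a) , _) (_ , maximal) =
    subst (_≤ b) (trans (length-map f C) |C|≡a) (maximal (List.map f C) (map-IsCode isCode))

corollary14 : (q n d w : ℕ) → q ≥ 3 → n ≥ 1 → d ≥ 1 → w ≥ 1 →
    (a b : ℕ) → IsA-Lee q n d a → IsA-bin (n * ⌈ w * q /2⌉) (d * w) b →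
    a ≤ b
corollary14 q n d w _ _ d≥1 w≥1 _ _ isA isB =
  maxCodeSize-mono (encode q w) hamming[u,u]≡0 (*-mono-≤ d≥1 w≥1) expanding isA isB
  where
  expanding : ∀ xs ys → d ≤ leeDist xs ys → d * w ≤ hamming (encode q w xs) (encode q w ys)
  expanding xs ys d≤ = begin
    d * w                                ≡⟨ *-comm d w ⟩
    w * d                                ≤⟨ *-monoʳ-≤ w d≤ ⟩
    w * leeDist xs ys                    ≤⟨ scaled-leeDist≤hamming q w xs ys ⟩
    hamming (encode q w xs) (encode q w ys) ∎
    where open ≤-Reasoning
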